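{- Let $\varepsilon>0$. Let $G$ be a $C_4$-free graph on $n$ vertices with minimum degree at least $n/2$. Suppose that $G$ contains an independent set of size $t\ge \frac{3}{\varepsilon}+1$. Then $G$ contains a clique of size at least $(1-\varepsilon)n/4$.
   Context: All graphs are finite and simple. A graph is called $C_4$-free if it does not contain the cycle on four vertices as an induced subgraph.
   Formalization: The parameter ε ranges over the positive rationals. -}

module Defs where

open import Data.Nat using (ℕ; _≤_; _*_)
open import Data.Bool using (Bool; true; false; if_then_else_)
open import Data.Fin using (Fin)
open import Data.List using (map; allFin)
open import Data.Nat.ListAction using (sum)
open import Data.Product using (∃; _×_)
open import Relation.Binary.PropositionalEquality using (_≡_; _≢_)
open import Relation.Nullary using (¬_)
open import Function.Definitions using (Injective)

record Graph (n : ℕ) : Set where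
  field
    adj     : Fin n → Fin n → Bool
    symm    : ∀ u v → adj u v ≡ adj v u
    irrefl  : ∀ v → adj v v ≡ false

open Graph public

_∼[_]_ : ∀ {n} → Fin n → Graph n → Fin n → Set
u ∼[ G ] v = adj G u v ≡ true

degree : ∀ {n} → Graph n → Fin n → ℕ
degree {n} G v = sum (map (λ u → if adj G v u then 1 else 0) (allFin n))

HasInducedC4 : ∀ {n} → Graph n → Set
HasInducedC4 {n} G =
  ∃ λ (a : Fin n) → ∃ λ (b : Fin n) → ∃ λ (c : Fin n) → ∃ λ (d : Fin n) →
    (a ≢ b) × (a ≢ c) × (a ≢ d) × (b ≢ c) × (b ≢ d) × (c ≢ d) ×
    (a ∼[ G ] b) × (b ∼[ G ] c) × (c ∼[ G ] d) × (d ∼[ G ] a) ×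
    ¬ (a ∼[ G ] c) × ¬ (b ∼[ G ] d)

C4Free : ∀ {n} → Graph n → Set
C4Free G = ¬ HasInducedC4 G

MinDegreeAtLeastHalf : ∀ {n} → Graph n → Set
MinDegreeAtLeastHalf {n} G = ∀ v → n ≤ 2 * degree G v

IndependentSetOfSize : ∀ {n} → Graph n → ℕ → Set
IndependentSetOfSize {n} G t =
  ∃ λ (f : Fin t → Fin n) → Injective _≡_ _≡_ f ×
    (∀ i j → ¬ (f i ∼[ G ] f j))

CliqueOfSize : ∀ {n} → Graph n → ℕ → Set
CliqueOfSize {n} G k =
  ∃ λ (f : Fin k → Fin n) → Injective _≡_ _≡_ f ×
    (∀ i j → i ≢ j → f i ∼[ G ] f j)

-- Let f : Fin t → Fin n list the independent set and let d x be the number of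
-- neighbours of the vertex x among the f i.  Double counting gives
--   S := Σ_x d x = Σ_i deg (f i)   and   Σ_x (d x)² = S + C,
-- where C = Σ_{i ≠ j} codeg (f i) (f j) counts the common neighbours of ordered
-- pairs of distinct vertices of the independent set.  Cauchy–Schwarz gives
-- S² ≤ n (S + C) and the minimum degree condition gives t n ≤ 2 S.  Since G is
-- C4-free, the common neighbourhood of two distinct non-adjacent vertices is a
-- clique, so averaging over the t² ordered pairs yields a clique of size k with
-- C ≤ t² k.  Eliminating S and C gives n t ≤ 4 t k + 2 n in ℕ (module Counting).
-- Finally t ≥ 3/ε + 1 gives ε t ≥ 2, which turns this into (1 - ε) n/4 ≤ k in ℚ
-- (module RationalBound); corollary5 combines the two.

module Submission where

module Counting where

  open import Defs
  open import Data.Nat.Properties hiding (_≟_; suc-injective)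
  open import Algebra.Properties.Semiring.Sum +-*-semiring
    using (sum; sum-syntax; sum-cong-≗; ∑-distrib-+; ∑-comm; *-distribˡ-sum; *-distribʳ-sum)
  open import Data.Bool using (Bool; true; false; if_then_else_; _∧_)
  open import Data.Bool.Properties using (∧-idem)
  open import Data.Empty using (⊥-elim)
  open import Data.Fin using (Fin; zero; suc; lift)
  open import Data.Fin.Properties using (_≟_; lift-injective; suc-injective)
  open import Data.List using (map; tabulate)
  open import Data.List.Properties using (map-tabulate)
  import Data.Nat.ListAction as List
  open import Data.Nat using (ℕ; zero; suc; _+_; _*_; _∸_; _≤_; z≤n; _≤?_)
  open import Data.Nat.Solver using (module +-*-Solver)
  open import Data.Product using (∃; _×_; _,_; proj₁; proj₂)
  open import Data.Sum using ([_,_]′)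
  open import Function using (_∘_)
  open import Function.Definitions using (Injective)
  open import Relation.Binary.PropositionalEquality hiding ([_])
  open import Relation.Nullary using (¬_; yes; no; does)
  open +-*-Solver using (solve; _:+_; _:*_; _:=_; con)

  sum-mono : ∀ {n} {f g : Fin n → ℕ} → (∀ i → f i ≤ g i) → sum f ≤ sum g
  sum-mono {zero}  f≤g = z≤n
  sum-mono {suc n} f≤g = +-mono-≤ (f≤g zero) (sum-mono (f≤g ∘ suc))

  sum-const : ∀ n c → ∑[ _ < n ] c ≡ n * c
  sum-const zero    c = refl
  sum-const (suc n) c = cong (c +_) (sum-const n c)

  sum-allFin : ∀ {n} (g : Fin n → ℕ) → List.sum (map g (tabulate (λ x → x))) ≡ sum g
  sum-allFin g = trans (cong List.sum (map-tabulate (λ x → x) g)) (sum-tabulate g)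
    where
    sum-tabulate : ∀ {n} (u : Fin n → ℕ) → List.sum (tabulate u) ≡ sum u
    sum-tabulate {zero}  u = refl
    sum-tabulate {suc n} u = cong (u zero +_) (sum-tabulate (u ∘ suc))

  -- g with its i-th entry replaced by 0; summing it sums g over j ≠ i.
  puncture : ∀ {n} → Fin n → (Fin n → ℕ) → Fin n → ℕ
  puncture i g j = if does (i ≟ j) then 0 else g j

  sum-puncture : ∀ {n} (i : Fin n) (g : Fin n → ℕ) → sum g ≡ g i + sum (puncture i g)
  sum-puncture zero    g = refl
  sum-puncture (suc i) g = begin
    g zero + sum (g ∘ suc)                         ≡⟨ cong (g zero +_) (sum-puncture i (g ∘ suc)) ⟩
    g zero + (g (suc i) + rest)   ≡⟨ sym (+-assoc (g zero) (g (suc i)) rest) ⟩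
    g zero + g (suc i) + rest     ≡⟨ cong (_+ rest) (+-comm (g zero) (g (suc i))) ⟩
    g (suc i) + g zero + rest     ≡⟨ +-assoc (g (suc i)) (g zero) rest ⟩
    g (suc i) + (g zero + rest)   ∎
    where
    open ≡-Reasoning
    rest : ℕ
    rest = sum (puncture i (g ∘ suc))

  sum-puncture-swap : ∀ {m n} (i : Fin n) (g : Fin m → Fin n → ℕ) j →
    ∑[ x < m ] puncture i (g x) j ≡ puncture i (λ j → ∑[ x < m ] g x j) j
  sum-puncture-swap {m} i g j with does (i ≟ j)
  ... | true  = trans (sum-const m 0) (*-zeroʳ m)
  ... | false = refl

  -- Averaging: if P holds for 0 and for every entry of f, then P holds for some
  -- k at least the mean of f.  (The value 0 covers an empty family.)
  averaging : ∀ {m} (f : Fin m → ℕ) (P : ℕ → Set) → P 0 → (∀ i → P (f i)) →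
    ∃ λ k → P k × sum f ≤ m * k
  averaging {zero}  f P P0 Pf = 0 , P0 , z≤n
  averaging {suc m} f P P0 Pf with averaging (f ∘ suc) P P0 (Pf ∘ suc)
  ... | k , Pk , rest≤ with k ≤? f zero
  ... | yes k≤f₀ = f zero , Pf zero , +-monoʳ-≤ (f zero) (≤-trans rest≤ (*-monoʳ-≤ m k≤f₀))
  ... | no  k≰f₀ = k , Pk , +-mono-≤ (<⇒≤ (≰⇒> k≰f₀)) rest≤

  averaging₂ : ∀ {m l} (f : Fin m → Fin l → ℕ) (P : ℕ → Set) → P 0 → (∀ i j → P (f i j)) →
    ∃ λ k → P k × ∑[ i < m ] sum (f i) ≤ l * (m * k)
  averaging₂ {m} {l} f P P0 Pf =
    let (k , Pk , best≤) = averaging best P P0 (λ i → proj₁ (proj₂ (row i))) in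
    k , Pk , (begin
      ∑[ i < m ] sum (f i)   ≤⟨ sum-mono (λ i → proj₂ (proj₂ (row i))) ⟩
      ∑[ i < m ] (l * best i)≡⟨ sym (*-distribˡ-sum l best) ⟩
      l * sum best           ≤⟨ *-monoʳ-≤ l best≤ ⟩
      l * (m * k)            ∎)
    where
    open ≤-Reasoning
    row : ∀ i → ∃ λ k → P k × sum (f i) ≤ l * k
    row i = averaging (f i) P P0 (Pf i)
    best : Fin m → ℕ
    best i = proj₁ (row i)

  am-gm : ∀ a b → 2 * (a * b) ≤ a * a + b * b
  am-gm a b = [ ordered , (λ b≤a → subst₂ _≤_ (cong (2 *_) (*-comm b a))
                                      (+-comm (b * b) (a * a)) (ordered b≤a)) ]′ (≤-total a b)
    where
    ordered : ∀ {a b} → a ≤ b → 2 * (a * b) ≤ a * a + b * b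
    ordered {a} a≤b with m≤n⇒∃[o]m+o≡n a≤b
    ... | c , refl = subst (2 * (a * (a + c)) ≤_)
          (solve 2 (λ a c → con 2 :* (a :* (a :+ c)) :+ c :* c
                              := a :* a :+ (a :+ c) :* (a :+ c)) refl a c)
          (m≤m+n (2 * (a * (a + c))) (c * c))

  -- Cauchy–Schwarz: (∑ d)² ≤ n ∑ d², by summing am-gm over all pairs.
  cauchy-schwarz : ∀ {n} (d : Fin n → ℕ) → sum d * sum d ≤ n * ∑[ x < n ] (d x * d x)
  cauchy-schwarz {n} d = *-cancelˡ-≤ 2 (begin
    2 * (sum d * sum d)                               ≡⟨ cong (2 *_) square ⟩
    2 * ∑[ x < n ] ∑[ y < n ] (d x * d y)              ≡⟨ double ⟩
    ∑[ x < n ] ∑[ y < n ] (2 * (d x * d y))            ≤⟨ sum-mono (λ x → sum-mono (λ y → am-gm (d x) (d y))) ⟩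
    ∑[ x < n ] ∑[ y < n ] (d x * d x + d y * d y)    ≡⟨ sum-cong-≗ (λ x → ∑-distrib-+ (λ _ → d x * d x) (λ y → d y * d y)) ⟩
    ∑[ x < n ] (∑[ _ < n ] (d x * d x) + Q)          ≡⟨ sum-cong-≗ (λ x → cong (_+ Q) (sum-const n (d x * d x))) ⟩
    ∑[ x < n ] (n * (d x * d x) + Q)                 ≡⟨ ∑-distrib-+ (λ x → n * (d x * d x)) (λ _ → Q) ⟩
    ∑[ x < n ] (n * (d x * d x)) + ∑[ _ < n ] Q        ≡⟨ cong₂ _+_ (sym (*-distribˡ-sum n (λ x → d x * d x))) (sum-const n Q) ⟩
    n * Q + n * Q                                     ≡⟨ cong (n * Q +_) (sym (+-identityʳ (n * Q))) ⟩
    2 * (n * Q)                                       ∎)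
    where
    open ≤-Reasoning
    Q : ℕ
    Q = ∑[ x < n ] (d x * d x)
    square : sum d * sum d ≡ ∑[ x < n ] ∑[ y < n ] (d x * d y)
    square = trans (*-distribʳ-sum (sum d) d) (sum-cong-≗ (λ x → *-distribˡ-sum (d x) d))
    double : 2 * ∑[ x < n ] ∑[ y < n ] (d x * d y) ≡ ∑[ x < n ] ∑[ y < n ] (2 * (d x * d y))
    double = trans (*-distribˡ-sum 2 (λ x → ∑[ y < n ] (d x * d y))) (sum-cong-≗ (λ x → *-distribˡ-sum 2 (λ y → d x * d y)))

  [_] : Bool → ℕ
  [ b ] = if b then 1 else 0

  [∧] : ∀ a b → [ a ] * [ b ] ≡ [ a ∧ b ]
  [∧] true  b = +-identityʳ [ b ]
  [∧] false b = refl

  ∧-true : ∀ {a b} → a ∧ b ≡ true → a ≡ true × b ≡ true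
  ∧-true {true} {true} _ = refl , refl

  false⇒¬true : ∀ {b} → b ≡ false → ¬ b ≡ true
  false⇒¬true refl ()

  ∼-sym : ∀ {n} (G : Graph n) {u v} → u ∼[ G ] v → v ∼[ G ] u
  ∼-sym G {u} {v} u∼v = trans (symm G v u) u∼v

  ∼⇒≢ : ∀ {n} (G : Graph n) {u v} → u ∼[ G ] v → u ≢ v
  ∼⇒≢ G {u} u∼u refl = false⇒¬true (irrefl G u) u∼u

  degree-sum : ∀ {n} (G : Graph n) v → degree G v ≡ ∑[ u < n ] [ adj G u v ]
  degree-sum G v = trans (sum-allFin (λ u → [ adj G v u ])) (sum-cong-≗ (λ u → cong [_] (symm G v u)))

  empty-clique : ∀ {n} (G : Graph n) → CliqueOfSize G 0
  empty-clique G = (λ ()) , (λ { {()} }) , (λ ())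

  enumerate : ∀ {n} (p : Fin n → Bool) →
    ∃ λ (g : Fin (∑[ x < n ] [ p x ]) → Fin n) → Injective _≡_ _≡_ g × (∀ k → p (g k) ≡ true)
  enumerate {zero}  p = (λ ()) , (λ { {()} }) , (λ ())
  enumerate {suc n} p with enumerate (p ∘ suc) | p zero in p₀
  ... | g , g-inj , g-sat | true  = lift 1 g , lift-injective g g-inj 1 , sat
    where
    sat : ∀ k → p (lift 1 g k) ≡ true
    sat zero    = p₀
    sat (suc k) = g-sat k
  ... | g , g-inj , g-sat | false = suc ∘ g , g-inj ∘ suc-injective , g-sat

  codegree : ∀ {n} → Graph n → Fin n → Fin n → ℕ
  codegree {n} G a c = ∑[ x < n ] [ adj G x a ∧ adj G x c ]

  -- In a C4-free graph the common neighbours of two distinct non-adjacent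
  -- vertices a, c form a clique: two non-adjacent common neighbours b, d would
  -- give the induced cycle a b c d.
  common-neighbours-clique : ∀ {n} (G : Graph n) → C4Free G →
    ∀ a c → a ≢ c → ¬ a ∼[ G ] c → CliqueOfSize G (codegree G a c)
  common-neighbours-clique G c4-free a c a≢c a≁c with enumerate (λ x → adj G x a ∧ adj G x c)
  ... | g , g-inj , g-common = g , g-inj , adjacent
    where
    adjacent : ∀ k l → k ≢ l → g k ∼[ G ] g l
    adjacent k l k≢l with adj G (g k) (g l) in gk≁gl
    ... | true  = refl
    ... | false = ⊥-elim (c4-free (a , g k , c , g l ,
          ∼⇒≢ G ab , a≢c , (λ a≡d → ∼⇒≢ G da (sym a≡d)) , ∼⇒≢ G bc ,
          (λ b≡d → k≢l (g-inj b≡d)) , ∼⇒≢ G cd ,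
          ab , bc , cd , da , a≁c , false⇒¬true gk≁gl))
      where
      ab : a ∼[ G ] g k
      ab = ∼-sym G (proj₁ (∧-true (g-common k)))
      bc : g k ∼[ G ] c
      bc = proj₂ (∧-true (g-common k))
      cd : c ∼[ G ] g l
      cd = ∼-sym G (proj₂ (∧-true (g-common l)))
      da : g l ∼[ G ] a
      da = proj₁ (∧-true (g-common l))

  module DoubleCounting {n t : ℕ} (G : Graph n) (f : Fin t → Fin n) where

    hit : Fin n → Fin t → ℕ
    hit x i = [ adj G x (f i) ]

    d : Fin n → ℕ
    d x = sum (hit x)

    common : Fin n → Fin t → Fin t → ℕ
    common x i j = [ adj G x (f i) ∧ adj G x (f j) ]

    pairCodegree : Fin t → Fin t → ℕ
    pairCodegree i = puncture i (λ j → codegree G (f i) (f j))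

    S : ℕ
    S = ∑[ i < t ] degree G (f i)

    C : ℕ
    C = ∑[ i < t ] sum (pairCodegree i)

    sum-d : sum d ≡ S
    sum-d = trans (∑-comm hit) (sum-cong-≗ (λ i → sym (degree-sum G (f i))))

    hit-d : ∀ x i → hit x i * d x ≡ hit x i + sum (puncture i (common x i))
    hit-d x i = begin
      hit x i * d x                                  ≡⟨ *-distribˡ-sum (hit x i) (hit x) ⟩
      ∑[ j < t ] (hit x i * hit x j)                 ≡⟨ sum-cong-≗ (λ j → [∧] (adj G x (f i)) (adj G x (f j))) ⟩
      sum (common x i)                               ≡⟨ sum-puncture i (common x i) ⟩
      common x i i + sum (puncture i (common x i))   ≡⟨ cong (λ b → [ b ] + sum (puncture i (common x i))) (∧-idem (adj G x (f i))) ⟩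
      hit x i + sum (puncture i (common x i))        ∎
      where open ≡-Reasoning

    sum-d² : ∑[ x < n ] (d x * d x) ≡ S + C
    sum-d² = begin
      ∑[ x < n ] (d x * d x)                                   ≡⟨ sum-cong-≗ (λ x → *-distribʳ-sum (d x) (hit x)) ⟩
      ∑[ x < n ] ∑[ i < t ] (hit x i * d x)                   ≡⟨ sum-cong-≗ (λ x → sum-cong-≗ (hit-d x)) ⟩
      ∑[ x < n ] ∑[ i < t ] (hit x i + off x i)               ≡⟨ sum-cong-≗ (λ x → ∑-distrib-+ (hit x) (off x)) ⟩
      ∑[ x < n ] (d x + sum (off x))                           ≡⟨ ∑-distrib-+ d (λ x → sum (off x)) ⟩
      sum d + ∑[ x < n ] sum (off x)                           ≡⟨ cong₂ _+_ sum-d (∑-comm off) ⟩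
      S + ∑[ i < t ] ∑[ x < n ] off x i                        ≡⟨ cong (S +_) (sum-cong-≗ (λ i → ∑-comm (λ x → puncture i (common x i)))) ⟩
      S + ∑[ i < t ] ∑[ j < t ] ∑[ x < n ] puncture i (common x i) j
                                                               ≡⟨ cong (S +_) (sum-cong-≗ (λ i → sum-cong-≗ (sum-puncture-swap i (λ x → common x i)))) ⟩
      S + C                                                    ∎
      where
      open ≡-Reasoning
      off : Fin n → Fin t → ℕ
      off x i = sum (puncture i (common x i))

    square-bound : S * S ≤ n * (S + C)
    square-bound = subst₂ (λ s q → s * s ≤ n * q) sum-d sum-d² (cauchy-schwarz d)

    degree-bound : MinDegreeAtLeastHalf G → t * n ≤ 2 * S
    degree-bound min-deg = begin
      t * n                          ≡⟨ sym (sum-const t n) ⟩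
      ∑[ _ < t ] n                   ≤⟨ sum-mono (λ i → min-deg (f i)) ⟩
      ∑[ i < t ] (2 * degree G (f i))  ≡⟨ sym (*-distribˡ-sum 2 (λ i → degree G (f i))) ⟩
      2 * S                          ∎
      where open ≤-Reasoning

    pair-clique : C4Free G → Injective _≡_ _≡_ f → (∀ i j → ¬ f i ∼[ G ] f j) →
      ∀ i j → CliqueOfSize G (pairCodegree i j)
    pair-clique c4-free f-inj f-indep i j with i ≟ j
    ... | yes _   = empty-clique G
    ... | no  i≢j = common-neighbours-clique G c4-free (f i) (f j) (i≢j ∘ f-inj) (f-indep i j)

  quadratic-bound : ∀ X m Q → X * X ≤ X * m + Q → X * (X ∸ m) ≤ Q
  quadratic-bound X m Q X²≤ rewrite *-distribˡ-∸ X X m = m≤n+o⇒m∸n≤o (X * X) (X * m) X²≤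

  -- Elimination of S and C: with X ↦ X (X ∸ 2n) monotone,
  -- (t n)(t n ∸ 2n) ≤ 2S (2S ∸ 2n) ≤ 4 n C ≤ 4 n t² k, and dividing by n t
  -- gives n (t ∸ 2) ≤ 4 t k.
  eliminate : ∀ n t k S C → S * S ≤ n * (S + C) → C ≤ t * (t * k) → t * n ≤ 2 * S →
    n * t ≤ 4 * t * k + 2 * n
  eliminate zero    t       k S C _ _ _ = z≤n
  eliminate (suc m) zero    k S C _ _ _ = ≤-trans (≤-reflexive (*-zeroʳ m)) z≤n
  eliminate n@(suc _) t@(suc _) k S C S²≤ C≤ tn≤2S = begin
    n * t                 ≤⟨ *-monoʳ-≤ n (m≤n+m∸n t 2) ⟩
    n * (2 + (t ∸ 2))     ≡⟨ solve 2 (λ n u → n :* (con 2 :+ u) := n :* u :+ con 2 :* n) refl n (t ∸ 2) ⟩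
    n * (t ∸ 2) + 2 * n   ≤⟨ +-monoˡ-≤ (2 * n) (*-cancelˡ-≤ (n * t) cancelled) ⟩
    4 * t * k + 2 * n     ∎
    where
    open ≤-Reasoning
    X²-bound : 2 * S * (2 * S) ≤ 2 * S * (2 * n) + 4 * n * C
    X²-bound = begin
      2 * S * (2 * S)              ≡⟨ solve 1 (λ S → con 2 :* S :* (con 2 :* S) := con 4 :* (S :* S)) refl S ⟩
      4 * (S * S)                  ≤⟨ *-monoʳ-≤ 4 S²≤ ⟩
      4 * (n * (S + C))            ≡⟨ solve 3 (λ n S C → con 4 :* (n :* (S :+ C))
                                         := con 2 :* S :* (con 2 :* n) :+ con 4 :* n :* C) refl n S C ⟩
      2 * S * (2 * n) + 4 * n * C  ∎
    cancelled : n * t * (n * (t ∸ 2)) ≤ n * t * (4 * t * k)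
    cancelled = begin
      n * t * (n * (t ∸ 2))        ≡⟨ cong (λ u → n * t * u) (trans (*-comm n (t ∸ 2)) (*-distribʳ-∸ n t 2)) ⟩
      n * t * (t * n ∸ 2 * n)      ≡⟨ cong (λ u → u * (t * n ∸ 2 * n)) (*-comm n t) ⟩
      t * n * (t * n ∸ 2 * n)      ≤⟨ *-mono-≤ tn≤2S (∸-monoˡ-≤ (2 * n) tn≤2S) ⟩
      2 * S * (2 * S ∸ 2 * n)      ≤⟨ quadratic-bound (2 * S) (2 * n) (4 * n * C) X²-bound ⟩
      4 * n * C                    ≤⟨ *-monoʳ-≤ (4 * n) C≤ ⟩
      4 * n * (t * (t * k))        ≡⟨ solve 3 (λ n t k → con 4 :* n :* (t :* (t :* k))
                                         := n :* t :* (con 4 :* t :* k)) refl n t k ⟩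
      n * t * (4 * t * k)          ∎

  large-clique : ∀ {n} (G : Graph n) → C4Free G → MinDegreeAtLeastHalf G →
    ∀ t → IndependentSetOfSize G t → ∃ λ k → CliqueOfSize G k × n * t ≤ 4 * t * k + 2 * n
  large-clique {n} G c4-free min-deg t (f , f-inj , f-indep) =
    let (k , k-clique , C≤) = averaging₂ pairCodegree (CliqueOfSize G) (empty-clique G)
                                (pair-clique c4-free f-inj f-indep)
    in k , k-clique , eliminate n t k S C square-bound C≤ (degree-bound min-deg)
    where open DoubleCounting G f

module RationalBound where

  open import Data.Integer as ℤ using (+_)
  import Data.Integer.Properties as ℤ
  open import Data.Nat as ℕ using (ℕ)
  import Data.Nat.Coprimality as Coprimality
  open import Data.Rational
  open import Data.Rational.Properties
  open import Data.Rational.Solver using (module +-*-Solver)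
  import Data.Rational.Unnormalised as ℚᵘ
  import Data.Rational.Unnormalised.Properties as ℚᵘ
  open import Relation.Binary.PropositionalEquality
  open +-*-Solver

  ι : ℕ → ℚ
  ι a = + a / 1

  ι-toℚᵘ : ∀ a → toℚᵘ (ι a) ≡ ℚᵘ.mkℚᵘ (+ a) 0
  ι-toℚᵘ a = cong toℚᵘ (normalize-coprime (Coprimality.sym (Coprimality.1-coprimeTo a)))

  ι-mono : ∀ {a b} → a ℕ.≤ b → ι a ≤ ι b
  ι-mono {a} {b} a≤b = toℚᵘ-cancel-≤ (subst₂ ℚᵘ._≤_ (sym (ι-toℚᵘ a)) (sym (ι-toℚᵘ b))
    (ℚᵘ.*≤* (ℤ.*-monoʳ-≤-nonNeg (+ 1) (ℤ.+≤+ a≤b))))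

  ι-+ : ∀ a b → ι (a ℕ.+ b) ≡ ι a + ι b
  ι-+ a b = toℚᵘ-injective (ℚᵘ.≃-trans (ℚᵘ.≃-reflexive (ι-toℚᵘ (a ℕ.+ b)))
    (ℚᵘ.≃-trans numerators (ℚᵘ.≃-sym (ℚᵘ.≃-trans (toℚᵘ-homo-+ (ι a) (ι b))
      (ℚᵘ.≃-reflexive (cong₂ ℚᵘ._+_ (ι-toℚᵘ a) (ι-toℚᵘ b)))))))
    where
    numerators : ℚᵘ.mkℚᵘ (+ (a ℕ.+ b)) 0 ℚᵘ.≃ ℚᵘ.mkℚᵘ (+ a) 0 ℚᵘ.+ ℚᵘ.mkℚᵘ (+ b) 0
    numerators = ℚᵘ.*≡* (cong (ℤ._* + 1) (trans (ℤ.pos-+ a b)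
      (cong₂ ℤ._+_ (sym (ℤ.*-identityʳ (+ a))) (sym (ℤ.*-identityʳ (+ b))))))

  ι-* : ∀ a b → ι (a ℕ.* b) ≡ ι a * ι b
  ι-* a b = toℚᵘ-injective (ℚᵘ.≃-trans (ℚᵘ.≃-reflexive (ι-toℚᵘ (a ℕ.* b)))
    (ℚᵘ.≃-trans numerators (ℚᵘ.≃-sym (ℚᵘ.≃-trans (toℚᵘ-homo-* (ι a) (ι b))
      (ℚᵘ.≃-reflexive (cong₂ ℚᵘ._*_ (ι-toℚᵘ a) (ι-toℚᵘ b)))))))
    where
    numerators : ℚᵘ.mkℚᵘ (+ (a ℕ.* b)) 0 ℚᵘ.≃ ℚᵘ.mkℚᵘ (+ a) 0 ℚᵘ.* ℚᵘ.mkℚᵘ (+ b) 0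
    numerators = ℚᵘ.*≡* (cong (ℤ._* + 1) (ℤ.pos-* a b))

  cast-bound : ∀ n t k → n ℕ.* t ℕ.≤ 4 ℕ.* t ℕ.* k ℕ.+ 2 ℕ.* n →
    ι n * ι t ≤ ι 4 * ι t * ι k + ι 2 * ι n
  cast-bound n t k le = subst₂ _≤_ (ι-* n t)
    (trans (ι-+ (4 ℕ.* t ℕ.* k) (2 ℕ.* n))
      (cong₂ _+_ (trans (ι-* (4 ℕ.* t) k) (cong (_* ι k) (ι-* 4 t))) (ι-* 2 n)))
    (ι-mono le)

  -- t ≥ 3/ε + 1 implies ε t ≥ 3 + ε ≥ 2.
  two≤εT : ∀ ε (ε>0 : 0ℚ < ε) T → _÷_ (ι 3) ε {{>-nonZero ε>0}} + 1ℚ ≤ T → ι 2 ≤ ε * T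
  two≤εT ε ε>0 T T-large = begin
    ι 2                       ≤⟨ ι-mono {2} {3} (ℕ.s≤s (ℕ.s≤s ℕ.z≤n)) ⟩
    ι 3                       ≡⟨ sym (+-identityʳ (ι 3)) ⟩
    ι 3 + 0ℚ                  ≤⟨ +-monoʳ-≤ (ι 3) (<⇒≤ ε>0) ⟩
    ι 3 + ε                   ≡⟨ sym expand ⟩
    ε * (ι 3 * 1/ ε + 1ℚ)     ≤⟨ *-monoˡ-≤-nonNeg ε T-large ⟩
    ε * T                     ∎
    where
    open ≤-Reasoning
    instance
      ε≢0 : NonZero ε
      ε≢0 = >-nonZero ε>0
      ε≥0 : NonNegative ε
      ε≥0 = nonNegative (<⇒≤ ε>0)
    expand : ε * (ι 3 * 1/ ε + 1ℚ) ≡ ι 3 + ε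
    expand = begin-equality
      ε * (ι 3 * 1/ ε + 1ℚ)   ≡⟨ solve 3 (λ e x w → e :* (x :* w :+ con 1ℚ) := x :* (e :* w) :+ e) refl ε (ι 3) (1/ ε) ⟩
      ι 3 * (ε * 1/ ε) + ε    ≡⟨ cong (λ u → ι 3 * u + ε) (*-inverseʳ ε) ⟩
      ι 3 * 1ℚ + ε            ≡⟨ cong (_+ ε) (*-identityʳ (ι 3)) ⟩
      ι 3 + ε                 ∎

  -- From N T ≤ 4 T K + 2 N and 2 ≤ ε T (so T > 0) follows (1 - ε) N/4 ≤ K:
  -- (1 - ε) N T = N T - ε T N ≤ 4 T K + 2 N - ε T N ≤ 4 T K.
  quarter-bound : ∀ ε N T K → 0ℚ < ε → 0ℚ ≤ N →
    N * T ≤ ι 4 * T * K + ι 2 * N → ι 2 ≤ ε * T → (1ℚ - ε) * N * (+ 1 / 4) ≤ K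
  quarter-bound ε N T K ε>0 N≥0 NT≤ 2≤εT = *-cancelʳ-≤-pos (ι 4 * T) (begin
    (1ℚ - ε) * N * (+ 1 / 4) * (ι 4 * T) ≡⟨ solve 3 (λ e N T → (con 1ℚ :- e) :* N :* con (+ 1 / 4) :* (con (ι 4) :* T)
                                              := N :* T :- e :* T :* N) refl ε N T ⟩
    N * T - ε * T * N                     ≤⟨ +-monoˡ-≤ (- (ε * T * N)) NT≤ ⟩
    ι 4 * T * K + ι 2 * N - ε * T * N     ≤⟨ +-monoˡ-≤ (- (ε * T * N)) (+-monoʳ-≤ (ι 4 * T * K) (*-monoʳ-≤-nonNeg N 2≤εT)) ⟩
    ι 4 * T * K + ε * T * N - ε * T * N   ≡⟨ solve 4 (λ e N T K → con (ι 4) :* T :* K :+ e :* T :* N :- e :* T :* N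
                                              := K :* (con (ι 4) :* T)) refl ε N T K ⟩
    K * (ι 4 * T)                         ∎)
    where
    open ≤-Reasoning
    instance
      N-nonNeg : NonNegative N
      N-nonNeg = nonNegative N≥0
      ε-nonNeg : NonNegative ε
      ε-nonNeg = nonNegative (<⇒≤ ε>0)
      T-pos : Positive T
      T-pos = positive (*-cancelˡ-<-nonNeg ε (begin-strict
        ε * 0ℚ  ≡⟨ *-zeroʳ ε ⟩
        0ℚ      <⟨ *<* (ℤ.+<+ (ℕ.s≤s ℕ.z≤n)) ⟩
        ι 2     ≤⟨ 2≤εT ⟩
        ε * T   ∎))
      4T-pos : Positive (ι 4 * T)
      4T-pos = pos*pos⇒pos (ι 4) T

open import Defs
open import Data.Nat using (ℕ; z≤n)
open import Data.Integer using (+_)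
open import Data.Rational using (ℚ; 0ℚ; 1ℚ; _<_; _≤_; _+_; _-_; _*_; _/_; _÷_; >-nonZero)
open import Data.Product using (∃; _×_; _,_)
open Counting using (large-clique)
open RationalBound using (ι-mono; cast-bound; two≤εT; quarter-bound)

corollary5 : (ε : ℚ) (ε>0 : 0ℚ < ε) (n : ℕ) (G : Graph n) →
    C4Free G → MinDegreeAtLeastHalf G →
    (t : ℕ) → IndependentSetOfSize G t →
    _÷_ (+ 3 / 1) ε {{>-nonZero ε>0}} + 1ℚ ≤ + t / 1 →
    ∃ λ (k : ℕ) → CliqueOfSize G k × ((1ℚ - ε) * (+ n / 1) * (+ 1 / 4) ≤ + k / 1)
corollary5 ε ε>0 n G c4-free min-deg t independent t-large =
  let (k , k-clique , counting) = large-clique G c4-free min-deg t independent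
  in k , k-clique , quarter-bound ε (+ n / 1) (+ t / 1) (+ k / 1) ε>0 (ι-mono {0} {n} z≤n)
                      (cast-bound n t k counting) (two≤εT ε ε>0 (+ t / 1) t-large)
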